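{- Let $G=(V,E)$ be a digraph, let $\mathcal{S}$ be the set of all maximal stable sets of $G$, and let $A$ be the $|V|\times|\mathcal{S}|$ matrix with $A(v,S)=1$ if $v\in N^+[S]$ and $A(v,S)=0$ otherwise. Then the optimal value of the linear program $\min\{\mathbf{1}^T z : Az\ge \mathbf{1},\ z\ge \mathbf{0}\}$ is at most $2$.
   Context: All digraphs are finite, loopless and simple (for any two vertices $u,v$ there is at most one arc with endpoints $\{u,v\}$). A stable set is a set of vertices no two of which are joined by an arc; it is maximal if it is maximal under inclusion. For $S\subseteq V$, $N^+[S]=S\cup\{y: xy\in E \text{ for some } x\in S\}$. -}

module Defs where

open import Data.Nat using (ℕ; zero; suc)
open import Data.Fin using (Fin)
open import Data.Fin.Subset using (Subset; _∈_; _⊆_; inside; outside)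
open import Data.Vec using (Vec; []; _∷_; lookup)
open import Data.List using (List; []; _∷_; _++_; map; foldr)
open import Data.Bool using (Bool; true; false; if_then_else_)
open import Data.Product using (_×_; ∃-syntax)
open import Data.Sum using (_⊎_)
open import Data.Rational using (ℚ; 0ℚ; _+_)
open import Relation.Binary.PropositionalEquality using (_≡_)
open import Relation.Nullary using (¬_)

record Digraph (n : ℕ) : Set where
  field
    arc      : Fin n → Fin n → Bool
    loopless : ∀ v → arc v v ≡ false
    simple   : ∀ u v → arc u v ≡ true → arc v u ≡ false
open Digraph public

Stable : ∀ {n} → Digraph n → Subset n → Set
Stable G S = ∀ u v → u ∈ S → v ∈ S → arc G u v ≡ false

MaximalStable : ∀ {n} → Digraph n → Subset n → Set
MaximalStable G S = Stable G S × (∀ T → Stable G T → S ⊆ T → T ⊆ S)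

anyFin : ∀ {n} → (Fin n → Bool) → Bool
anyFin {zero}  f = false
anyFin {suc n} f = f Fin.zero Data.Bool.∨ anyFin (λ i → f (Fin.suc i))
  where import Data.Bool

inClosedOutNbhd : ∀ {n} → Digraph n → Subset n → Fin n → Bool
inClosedOutNbhd G S v =
  lookup S v Data.Bool.∨ anyFin (λ x → lookup S x Data.Bool.∧ arc G x v)
  where import Data.Bool

allSubsets : ∀ n → List (Subset n)
allSubsets zero    = [] ∷ []
allSubsets (suc n) = map (inside ∷_) (allSubsets n) ++ map (outside ∷_) (allSubsets n)

sumSubsets : ∀ n → (Subset n → ℚ) → ℚ
sumSubsets n f = foldr (λ S acc → f S + acc) 0ℚ (allSubsets n)

-- The proof goes through LP duality, made constructive by Fourier–Motzkin
-- elimination over ℚ: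
--   * fourier-motzkin: if a notion of "derivable inequality" is closed under
--     non-negative combinations and never derives 0 ≥ b with b > 0, then any
--     finite list of derivable inequalities has a common rational solution;
--   * weighted-domination (the combinatorial heart, a greedy argument): for
--     vertex weights y ≥ 0 there is a dominating stable set S with
--     y(V) ≤ 2·y(N⁺[S]); the pivot of each greedy step is found by a double
--     counting of the arcs (averaging);
--   * CoveringLP: the LP  x ≥ 0, Ax ≥ 1, ∑x ≤ 2  over the dominating stable
--     sets (indexed by Fin (#subsets n)) has dual certificates (y, t) that are
--     consistent by weighted-domination, so Fourier–Motzkin gives a solution;
--     dominating stable sets are maximal stable, which yields lemma6.

module Submission where

open import Defs
open import Data.Nat using (ℕ; zero; suc) renaming (_+_ to _+ℕ_)
open import Data.Fin using (Fin; zero; suc; splitAt; _↑ˡ_; _↑ʳ_)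
open import Data.Fin.Properties using (any?; all?; splitAt-↑ˡ; splitAt-↑ʳ; splitAt⁻¹-↑ˡ; splitAt⁻¹-↑ʳ)
open import Data.Fin.Subset using (Subset; inside; outside; ⊤; _⊆_; _⊂_; _∉_)
open import Data.Vec using ([]; _∷_; lookup; tabulate; replicate)
open import Data.Vec.Properties using (lookup∘tabulate; lookup-replicate; []=⇒lookup; lookup⇒[]=)
open import Data.Bool using (Bool; true; false; if_then_else_; _∨_; _∧_; not)
open import Data.Bool.Properties using (∨-zeroʳ; ∧-zeroʳ; ¬-not) renaming (_≟_ to _≟ᵇ_)
open import Data.Product using (_×_; ∃-syntax; _,_; proj₁; proj₂)
open import Data.Sum using (_⊎_; inj₁; inj₂; [_,_]′)
open import Data.Rational
open import Data.Rational.Properties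
open import Data.Rational.Solver using (module +-*-Solver)
open import Data.Vec.Functional using () renaming (_∷_ to _◂_)
open import Data.List using (List; map; _++_; foldr; filter; cartesianProductWith; allFin) renaming ([] to []ᴸ; _∷_ to _∷ᴸ_)
open import Data.List.Relation.Unary.All as All using (All)
import Data.List.Relation.Unary.All.Properties as AllP
open import Data.List.Membership.Propositional using (_∈_)
open import Data.List.Relation.Unary.Any using (here)
open import Data.List.Membership.Propositional.Properties
  using (∈-++⁻; ∈-++⁺ˡ; ∈-++⁺ʳ; ∈-map⁺; ∈-map⁻; ∈-filter⁺; ∈-filter⁻;
         ∈-cartesianProductWith⁺; ∈-cartesianProductWith⁻; ∈-allFin)
open import Algebra.Bundles using (CommutativeRing)
open import Relation.Binary.Bundles using (DecTotalOrder)
open import Relation.Binary.Definitions using (tri<; tri≈; tri>)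
open import Relation.Binary.PropositionalEquality
open import Relation.Nullary using (¬_; yes; no; Dec; does)
open import Relation.Nullary.Decidable using (_×-dec_; _→-dec_; _⊎-dec_; dec-true; dec-false)
open import Relation.Nullary.Negation using (contradiction)
open import Data.Empty using (⊥-elim)
open import Data.Fin.Subset.Induction using (Acc; acc; ⊂-wellFounded)

open import Algebra.Properties.Semiring.Sum (CommutativeRing.semiring +-*-commutativeRing)
  using (sum; ∑-distrib-+; ∑-comm; sum-cong-≗; *-distribˡ-sum; sum-replicate-zero)
import Data.List.Extrema (DecTotalOrder.totalOrder ≤-decTotalOrder) as Extrema
open +-*-Solver using (solve; _:+_; _:*_; _:-_; :-_; _:=_; con)

∑-mono : ∀ {m} {f g : Fin m → ℚ} → (∀ i → f i ≤ g i) → sum f ≤ sum g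
∑-mono {zero}  f≤g = ≤-refl
∑-mono {suc m} f≤g = +-mono-≤ (f≤g zero) (∑-mono (λ i → f≤g (suc i)))

∑-nonneg : ∀ {m} {f : Fin m → ℚ} → (∀ i → 0ℚ ≤ f i) → 0ℚ ≤ sum f
∑-nonneg {m} {f} 0≤f = subst (_≤ sum f) (sum-replicate-zero m) (∑-mono 0≤f)

∑-mono-< : ∀ {m} {f g : Fin m → ℚ} → (∀ i → f i ≤ g i) → ∀ j → f j < g j → sum f < sum g
∑-mono-< f≤g zero    f<g = +-mono-<-≤ f<g (∑-mono (λ i → f≤g (suc i)))
∑-mono-< f≤g (suc j) f<g = +-mono-≤-< (f≤g zero) (∑-mono-< (λ i → f≤g (suc i)) j f<g)

∑-linear : ∀ {m} α β (f g : Fin m → ℚ) → sum (λ i → α * f i + β * g i) ≡ α * sum f + β * sum g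
∑-linear α β f g = trans (∑-distrib-+ (λ i → α * f i) (λ i → β * g i))
                         (sym (cong₂ _+_ (*-distribˡ-sum α f) (*-distribˡ-sum β g)))

combine-mono : ∀ {α β p₁ q₁ p₂ q₂} → 0ℚ ≤ α → 0ℚ ≤ β → p₁ ≤ q₁ → p₂ ≤ q₂ → α * p₁ + β * p₂ ≤ α * q₁ + β * q₂
combine-mono {α} {β} 0≤α 0≤β p₁≤q₁ p₂≤q₂ =
  +-mono-≤ (*-monoˡ-≤-nonNeg α {{nonNegative 0≤α}} p₁≤q₁) (*-monoˡ-≤-nonNeg β {{nonNegative 0≤β}} p₂≤q₂)

combine-nonneg : ∀ {α β a b} → 0ℚ ≤ α → 0ℚ ≤ β → 0ℚ ≤ a → 0ℚ ≤ b → 0ℚ ≤ α * a + β * b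
combine-nonneg {α} {β} {a} {b} 0≤α 0≤β 0≤a 0≤b =
  subst (_≤ α * a + β * b) (trans (cong₂ _+_ (*-zeroʳ α) (*-zeroʳ β)) (+-identityʳ 0ℚ)) (combine-mono 0≤α 0≤β 0≤a 0≤b)

-- Division, made total by returning 0 for a zero divisor.
_⊘_ : ℚ → ℚ → ℚ
a ⊘ d with d ≟ 0ℚ
... | yes _   = 0ℚ
... | no d≢0 = (a ÷ d) {{≢-nonZero d≢0}}

*-⊘ : ∀ a d → d ≢ 0ℚ → d * (a ⊘ d) ≡ a
*-⊘ a d d≢0 with d ≟ 0ℚ
... | yes d≡0 = contradiction d≡0 d≢0
... | no d≢0′ = begin
  d * (a * 1/d)  ≡⟨ solve 3 (λ d a e → d :* (a :* e) := a :* (d :* e)) refl d a 1/d ⟩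
  a * (d * 1/d)  ≡⟨ cong (a *_) (*-inverseʳ d {{≢-nonZero d≢0′}}) ⟩
  a * 1ℚ         ≡⟨ *-identityʳ a ⟩
  a              ∎
  where
  open ≡-Reasoning
  1/d = (1/ d) {{≢-nonZero d≢0′}}

rearrange : ∀ {a b c d} → a + b ≤ c + d → a - c ≤ d - b
rearrange {a} {b} {c} {d} h =
  subst₂ _≤_ (solve 4 (λ a b c d → (a :+ b) :+ (:- c :+ :- b) := a :- c) refl a b c d)
             (solve 4 (λ a b c d → (c :+ d) :+ (:- c :+ :- b) := d :- b) refl a b c d)
             (+-monoˡ-≤ (- c + - b) h)

≤-+-move : ∀ {b r s} → b - r ≤ s → b ≤ s + r
≤-+-move {b} {r} {s} h =
  subst (_≤ s + r) (solve 2 (λ b r → (b :- r) :+ r := b) refl b r) (+-monoˡ-≤ r h)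

record Ineq (m : ℕ) : Set where
  constructor ineq
  field
    coef : Fin m → ℚ
    rhs  : ℚ
open Ineq

lhs : ∀ {m} → Ineq m → (Fin m → ℚ) → ℚ
lhs e x = sum (λ i → coef e i * x i)

_⊨_ : ∀ {m} → (Fin m → ℚ) → Ineq m → Set
x ⊨ e = rhs e ≤ lhs e x

combine : ∀ {m} → ℚ → Ineq m → ℚ → Ineq m → Ineq m
combine α e β f = ineq (λ i → α * coef e i + β * coef f i) (α * rhs e + β * rhs f)

lhs-combine : ∀ {m} α e β f (x : Fin m → ℚ) →
              lhs (combine α e β f) x ≡ α * lhs e x + β * lhs f x
lhs-combine α e β f x =
  trans (sum-cong-≗ (λ i → solve 5 (λ α a β b y → (α :* a :+ β :* b) :* y := α :* (a :* y) :+ β :* (b :* y))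
                                  refl α (coef e i) β (coef f i) (x i)))
        (∑-linear α β (λ i → coef e i * x i) (λ i → coef f i * x i))

-- An abstract notion of "derivable inequality": closed under non-negative
-- combinations, and never deriving the contradiction 0 ≥ b with b > 0.
-- (Typically: the consequences of a system certified by Farkas multipliers.)
record Consistent {m : ℕ} (Derivable : Ineq m → Set) : Set where
  field
    coef-cong : ∀ {c c′ b} → (∀ i → c i ≡ c′ i) → Derivable (ineq c b) → Derivable (ineq c′ b)
    conic     : ∀ {α β e f} → 0ℚ ≤ α → 0ℚ ≤ β → Derivable e → Derivable f →
                Derivable (combine α e β f)
    sound     : ∀ {e} → Derivable e → (∀ i → coef e i ≡ 0ℚ) → rhs e ≤ 0ℚ

module Elimination {m : ℕ} where

  lead : Ineq (suc m) → ℚ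
  lead e = coef e zero

  -- e without its first unknown (meaningful when that coefficient vanishes).
  tail₀ : Ineq (suc m) → Ineq m
  tail₀ e = ineq (λ i → coef e (suc i)) (rhs e)

  lift₀ : Ineq m → Ineq (suc m)
  lift₀ e = ineq (0ℚ ◂ coef e) (rhs e)

  cancel : Ineq (suc m) → Ineq (suc m) → Ineq (suc m)
  cancel p q = combine (- lead q) p (lead p) q

  lowers uppers neutrals : List (Ineq (suc m)) → List (Ineq (suc m))
  lowers   = filter (λ e → 0ℚ <? lead e)
  uppers   = filter (λ e → lead e <? 0ℚ)
  neutrals = filter (λ e → lead e ≟ 0ℚ)

  eliminate : List (Ineq (suc m)) → List (Ineq m)
  eliminate L = map tail₀ (neutrals L)
             ++ cartesianProductWith (λ p q → tail₀ (cancel p q)) (lowers L) (uppers L)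

  data Eliminated (L : List (Ineq (suc m))) : Ineq m → Set where
    neutral : ∀ {e} → e ∈ L → lead e ≡ 0ℚ → Eliminated L (tail₀ e)
    paired  : ∀ {p q} → p ∈ L → 0ℚ < lead p → q ∈ L → lead q < 0ℚ →
              Eliminated L (tail₀ (cancel p q))

  ∈-eliminate⁻ : ∀ L {e} → e ∈ eliminate L → Eliminated L e
  ∈-eliminate⁻ L e∈ with ∈-++⁻ (map tail₀ (neutrals L)) e∈
  ... | inj₁ e∈map with ∈-map⁻ tail₀ e∈map
  ...   | e , e∈N , refl with ∈-filter⁻ (λ e → lead e ≟ 0ℚ) {xs = L} e∈N
  ...     | e∈L , lead≡0 = neutral e∈L lead≡0
  ∈-eliminate⁻ L e∈ | inj₂ e∈pairs
    with ∈-cartesianProductWith⁻ (λ p q → tail₀ (cancel p q)) (lowers L) (uppers L) e∈pairs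
  ... | p , q , p∈ , q∈ , refl
    with ∈-filter⁻ (λ e → 0ℚ <? lead e) {xs = L} p∈ | ∈-filter⁻ (λ e → lead e <? 0ℚ) {xs = L} q∈
  ...   | p∈L , 0<p | q∈L , q<0 = paired p∈L 0<p q∈L q<0

  module _ {D : Ineq (suc m) → Set} (consistent : Consistent D) where
    open Consistent consistent

    D₀ : Ineq m → Set
    D₀ e = D (lift₀ e)

    consistent₀ : Consistent D₀
    consistent₀ = record
      { coef-cong = λ c≗c′ → coef-cong (λ { zero → refl ; (suc i) → c≗c′ i })
      ; conic     = λ {α} {β} 0≤α 0≤β d d′ →
          coef-cong (λ { zero    → trans (cong₂ _+_ (*-zeroʳ α) (*-zeroʳ β)) (+-identityʳ 0ℚ)
                       ; (suc i) → refl })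
                    (conic 0≤α 0≤β d d′)
      ; sound     = λ d c≡0 → sound d (λ { zero → refl ; (suc i) → c≡0 i })
      }

    eliminate-derivable : ∀ L → All D L → All D₀ (eliminate L)
    eliminate-derivable L dL = All.tabulate (λ e∈ → derivable (∈-eliminate⁻ L e∈))
      where
      derivable : ∀ {e} → Eliminated L e → D₀ e
      derivable (neutral e∈ lead≡0) =
        coef-cong (λ { zero → lead≡0 ; (suc i) → refl }) (All.lookup dL e∈)
      derivable (paired {p} {q} p∈ 0<p q∈ q<0) =
        coef-cong (λ { zero    → solve 2 (λ a b → (:- b) :* a :+ a :* b := con 0ℚ) refl (lead p) (lead q)
                     ; (suc i) → refl })
                  (conic (<⇒≤ (neg-antimono-< q<0)) (<⇒≤ 0<p) (All.lookup dL p∈) (All.lookup dL q∈))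

  -- Each inequality e with lead e ≠ 0 becomes a bound on y,
  -- namely y ≥ threshold e (lead e > 0) or y ≤ threshold e (lead e < 0).
  module Extend (x′ : Fin m → ℚ) where

    slack : Ineq (suc m) → ℚ
    slack e = rhs e - lhs (tail₀ e) x′

    threshold : Ineq (suc m) → ℚ
    threshold e = slack e ⊘ lead e

    -- (y ◂ x′) ⊨ e unfolds to  rhs e ≤ lead e * y + lhs (tail₀ e) x′.
    sat-by-slack : ∀ {e y} → slack e ≤ lead e * y → (y ◂ x′) ⊨ e
    sat-by-slack {e} {y} = ≤-+-move {rhs e} {lhs (tail₀ e) x′} {lead e * y}

    sat-lower : ∀ {e y} → 0ℚ < lead e → threshold e ≤ y → (y ◂ x′) ⊨ e
    sat-lower {e} {y} 0<a t≤y = sat-by-slack {e} {y}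
      (subst (_≤ _) (*-⊘ (slack e) (lead e) (≢-sym (<⇒≢ 0<a)))
             (*-monoˡ-≤-nonNeg (lead e) {{nonNegative (<⇒≤ 0<a)}} t≤y))

    sat-upper : ∀ {e y} → lead e < 0ℚ → y ≤ threshold e → (y ◂ x′) ⊨ e
    sat-upper {e} {y} a<0 y≤t = sat-by-slack {e} {y}
      (subst (_≤ _) (*-⊘ (slack e) (lead e) (<⇒≢ a<0))
             (*-monoˡ-≤-nonPos (lead e) {{nonPositive (<⇒≤ a<0)}} y≤t))

    sat-neutral : ∀ {e y} → lead e ≡ 0ℚ → x′ ⊨ tail₀ e → (y ◂ x′) ⊨ e
    sat-neutral {e} {y} a≡0 sat = subst (rhs e ≤_) (sym lead-vanishes) sat
      where
      lead-vanishes : lead e * y + lhs (tail₀ e) x′ ≡ lhs (tail₀ e) x′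
      lead-vanishes = trans (cong (λ a → a * y + lhs (tail₀ e) x′) a≡0)
                            (trans (cong (_+ lhs (tail₀ e) x′) (*-zeroˡ y)) (+-identityˡ _))

    threshold-≤ : ∀ {p q} → 0ℚ < lead p → lead q < 0ℚ → x′ ⊨ tail₀ (cancel p q) →
                  threshold p ≤ threshold q
    threshold-≤ {p} {q} 0<a b<0 sat = *-cancelˡ-≤-pos k {{k-pos}} (subst₂ _≤_ (sym k·tp) (sym k·tq) combined)
      where
      a = lead p
      b = lead q
      k = a * (- b)
      k-pos : Positive k
      k-pos = pos*pos⇒pos a {{positive 0<a}} (- b) {{positive (neg-antimono-< b<0)}}
      lp = lhs (tail₀ p) x′
      lq = lhs (tail₀ q) x′
      sat′ : (- b) * rhs p + a * rhs q ≤ (- b) * lp + a * lq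
      sat′ = subst ((- b) * rhs p + a * rhs q ≤_) (lhs-combine (- b) (tail₀ p) a (tail₀ q) x′) sat
      combined : (- b) * slack p ≤ a * (- slack q)
      combined = subst₂ _≤_
        (solve 3 (λ b r l → (:- b) :* r :- (:- b) :* l := (:- b) :* (r :- l)) refl b (rhs p) lp)
        (solve 3 (λ a r l → a :* l :- a :* r := a :* (:- (r :- l))) refl a (rhs q) lq)
        (rearrange {(- b) * rhs p} {a * rhs q} {(- b) * lp} {a * lq} sat′)
      k·tp : k * threshold p ≡ (- b) * slack p
      k·tp = begin
        a * (- b) * threshold p   ≡⟨ solve 3 (λ a b t → a :* b :* t := b :* (a :* t)) refl a (- b) (threshold p) ⟩
        (- b) * (a * threshold p) ≡⟨ cong ((- b) *_) (*-⊘ (slack p) a (≢-sym (<⇒≢ 0<a))) ⟩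
        (- b) * slack p           ∎
        where open ≡-Reasoning
      k·tq : k * threshold q ≡ a * (- slack q)
      k·tq = begin
        a * (- b) * threshold q     ≡⟨ solve 3 (λ a b t → a :* (:- b) :* t := a :* (:- (b :* t))) refl a b (threshold q) ⟩
        a * (- (b * threshold q))   ≡⟨ cong (λ s → a * (- s)) (*-⊘ (slack q) b (<⇒≢ b<0)) ⟩
        a * (- slack q)             ∎
        where open ≡-Reasoning

    -- From a solution x′ of eliminate L, the first unknown is chosen as the
    -- largest lower threshold (or, if there is none, below every upper one).
    module _ (L : List (Ineq (suc m))) (sol : All (x′ ⊨_) (eliminate L)) where

      y₀ : ℚ
      y₀ = Extrema.max (Extrema.min 0ℚ (map threshold (uppers L))) (map threshold (lowers L))

      lower≤y₀ : ∀ {p} → p ∈ lowers L → threshold p ≤ y₀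
      lower≤y₀ = All.lookup (AllP.map⁻ (Extrema.xs≤max _ (map threshold (lowers L))))

      y₀≤upper : ∀ {q} → q ∈ uppers L → y₀ ≤ threshold q
      y₀≤upper {q} q∈ = Extrema.max≤v⁺ min≤q (AllP.map⁺ (All.tabulate lower≤q))
        where
        min≤q = All.lookup (AllP.map⁻ (Extrema.min≤xs 0ℚ (map threshold (uppers L)))) q∈
        q<0 = proj₂ (∈-filter⁻ (λ e → lead e <? 0ℚ) {xs = L} q∈)
        lower≤q : ∀ {p} → p ∈ lowers L → threshold p ≤ threshold q
        lower≤q {p} p∈ = threshold-≤ {p} {q} (proj₂ (∈-filter⁻ (λ e → 0ℚ <? lead e) {xs = L} p∈)) q<0
          (All.lookup sol (∈-++⁺ʳ (map tail₀ (neutrals L))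
                             (∈-cartesianProductWith⁺ (λ p q → tail₀ (cancel p q)) p∈ q∈)))

      extend : All ((y₀ ◂ x′) ⊨_) L
      extend = All.tabulate sat
        where
        sat : ∀ {e} → e ∈ L → (y₀ ◂ x′) ⊨ e
        sat {e} e∈ with <-cmp 0ℚ (lead e)
        ... | tri< 0<a _ _ = sat-lower {e} 0<a (lower≤y₀ (∈-filter⁺ (λ e → 0ℚ <? lead e) e∈ 0<a))
        ... | tri> _ _ a<0 = sat-upper {e} a<0 (y₀≤upper (∈-filter⁺ (λ e → lead e <? 0ℚ) e∈ a<0))
        ... | tri≈ _ 0≡a _ = sat-neutral {e} (sym 0≡a)
          (All.lookup sol (∈-++⁺ˡ (∈-map⁺ tail₀ (∈-filter⁺ (λ e → lead e ≟ 0ℚ) e∈ (sym 0≡a)))))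

fourier-motzkin : ∀ {m} {D : Ineq m → Set} → Consistent D →
                  (L : List (Ineq m)) → All D L → ∃[ x ] All (x ⊨_) L
fourier-motzkin {zero} consistent L dL =
  (λ ()) , All.map (λ d → Consistent.sound consistent d (λ ())) dL
fourier-motzkin {suc m} consistent L dL =
  let x′ , sol = fourier-motzkin (consistent₀ consistent) (eliminate L) (eliminate-derivable consistent L dL)
  in  Extend.y₀ x′ L sol ◂ x′ , Extend.extend x′ L sol
  where open Elimination

-- The LP has one unknown per subset of vertices, so subsets of Fin n are
-- enumerated by Fin (#subsets n): the first half of the indices are the subsets
-- containing 0, the second half those avoiding it, in the order of allSubsets.
#subsets : ℕ → ℕ
#subsets zero    = 1
#subsets (suc n) = #subsets n +ℕ #subsets n

subsetAt : ∀ {n} → Fin (#subsets n) → Subset n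
subsetAt {zero}  _ = []
subsetAt {suc n} i = [ (λ j → inside ∷ subsetAt j) , (λ j → outside ∷ subsetAt j) ]′ (splitAt (#subsets n) i)

indexOf : ∀ {n} → Subset n → Fin (#subsets n)
indexOf []                      = zero
indexOf {suc n} (inside ∷ S)  = indexOf S ↑ˡ #subsets n
indexOf {suc n} (outside ∷ S) = #subsets n ↑ʳ indexOf S

subsetAt-↑ˡ : ∀ {n} (j : Fin (#subsets n)) → subsetAt {suc n} (j ↑ˡ #subsets n) ≡ inside ∷ subsetAt j
subsetAt-↑ˡ {n} j rewrite splitAt-↑ˡ (#subsets n) j (#subsets n) = refl

subsetAt-↑ʳ : ∀ {n} (j : Fin (#subsets n)) → subsetAt {suc n} (#subsets n ↑ʳ j) ≡ outside ∷ subsetAt j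
subsetAt-↑ʳ {n} j rewrite splitAt-↑ʳ (#subsets n) (#subsets n) j = refl

subsetAt-indexOf : ∀ {n} (S : Subset n) → subsetAt (indexOf S) ≡ S
subsetAt-indexOf []            = refl
subsetAt-indexOf (inside ∷ S)  = trans (subsetAt-↑ˡ (indexOf S)) (cong (inside ∷_) (subsetAt-indexOf S))
subsetAt-indexOf (outside ∷ S) = trans (subsetAt-↑ʳ (indexOf S)) (cong (outside ∷_) (subsetAt-indexOf S))

indexOf-subsetAt : ∀ {n} (i : Fin (#subsets n)) → indexOf {n} (subsetAt i) ≡ i
indexOf-subsetAt {zero}  zero = refl
indexOf-subsetAt {suc n} i with splitAt (#subsets n) i in eq
... | inj₁ j = trans (cong (_↑ˡ #subsets n) (indexOf-subsetAt {n} j)) (splitAt⁻¹-↑ˡ eq)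
... | inj₂ j = trans (cong (#subsets n ↑ʳ_) (indexOf-subsetAt {n} j)) (splitAt⁻¹-↑ʳ eq)

∑-split : ∀ a b (f : Fin (a +ℕ b) → ℚ) → sum f ≡ sum (λ j → f (j ↑ˡ b)) + sum (λ j → f (a ↑ʳ j))
∑-split zero    b f = sym (+-identityˡ (sum f))
∑-split (suc a) b f = trans (cong (f zero +_) (∑-split a b (λ i → f (suc i)))) (sym (+-assoc (f zero) _ _))

listSum : ∀ {n} → (Subset n → ℚ) → List (Subset n) → ℚ
listSum f = foldr (λ S acc → f S + acc) 0ℚ

listSum-++ : ∀ {n} (f : Subset n → ℚ) xs ys → listSum f (xs ++ ys) ≡ listSum f xs + listSum f ys
listSum-++ f []ᴸ       ys = sym (+-identityˡ _)
listSum-++ f (x ∷ᴸ xs) ys = trans (cong (f x +_) (listSum-++ f xs ys)) (sym (+-assoc (f x) _ _))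

listSum-map : ∀ {k n} (f : Subset n → ℚ) (g : Subset k → Subset n) xs →
              listSum f (map g xs) ≡ listSum (λ S → f (g S)) xs
listSum-map f g []ᴸ       = refl
listSum-map f g (x ∷ᴸ xs) = cong (f (g x) +_) (listSum-map f g xs)

sumSubsets-∑ : ∀ n (f : Subset n → ℚ) → sumSubsets n f ≡ sum (λ i → f (subsetAt i))
sumSubsets-∑ zero    f = refl
sumSubsets-∑ (suc n) f = begin
  listSum f (map (inside ∷_) (allSubsets n) ++ map (outside ∷_) (allSubsets n))
    ≡⟨ listSum-++ f (map (inside ∷_) (allSubsets n)) _ ⟩
  listSum f (map (inside ∷_) (allSubsets n)) + listSum f (map (outside ∷_) (allSubsets n))
    ≡⟨ cong₂ _+_ (trans (listSum-map f (inside ∷_) (allSubsets n)) (sumSubsets-∑ n (λ S → f (inside ∷ S))))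
                 (trans (listSum-map f (outside ∷_) (allSubsets n)) (sumSubsets-∑ n (λ S → f (outside ∷ S)))) ⟩
  sum (λ j → f (inside ∷ subsetAt j)) + sum (λ j → f (outside ∷ subsetAt j))
    ≡⟨ sym (cong₂ _+_ (sum-cong-≗ (λ j → cong f (subsetAt-↑ˡ j))) (sum-cong-≗ (λ j → cong f (subsetAt-↑ʳ j)))) ⟩
  sum (λ j → f (subsetAt (j ↑ˡ #subsets n))) + sum (λ j → f (subsetAt (#subsets n ↑ʳ j)))
    ≡⟨ sym (∑-split (#subsets n) (#subsets n) (λ i → f (subsetAt i))) ⟩
  sum (λ i → f (subsetAt i)) ∎
  where open ≡-Reasoning

keepIf : Bool → ℚ → ℚ
keepIf b q = if b then q else 0ℚ

keepIf-nonneg : ∀ b {q} → 0ℚ ≤ q → 0ℚ ≤ keepIf b q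
keepIf-nonneg true  0≤q = 0≤q
keepIf-nonneg false 0≤q = ≤-refl

keepIf-≤ : ∀ b {q} → 0ℚ ≤ q → keepIf b q ≤ q
keepIf-≤ true  0≤q = ≤-refl
keepIf-≤ false 0≤q = 0≤q

keepIf-zero : ∀ b → keepIf b 0ℚ ≡ 0ℚ
keepIf-zero true  = refl
keepIf-zero false = refl

keepIf-one : ∀ b q → keepIf b 1ℚ * q ≡ keepIf b q
keepIf-one true  q = *-identityˡ q
keepIf-one false q = *-zeroˡ q

keepIf-nested : ∀ c d q → keepIf c (keepIf d q) ≡ keepIf c (keepIf d 1ℚ) * q
keepIf-nested true  d q = sym (keepIf-one d q)
keepIf-nested false d q = sym (*-zeroˡ q)

keepIf-∨ : ∀ a b q → (a ≡ true → b ≡ false) → keepIf (a ∨ b) q ≡ keepIf a q + keepIf b q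
keepIf-∨ true  true  q excl with excl refl
... | ()
keepIf-∨ true  false q excl = sym (+-identityʳ q)
keepIf-∨ false true  q excl = sym (+-identityˡ q)
keepIf-∨ false false q excl = refl

keepIf-swap : ∀ b x y → y * keepIf b x ≡ x * keepIf b y
keepIf-swap true  x y = *-comm y x
keepIf-swap false x y = trans (*-zeroʳ y) (sym (*-zeroʳ x))

∨-introˡ : ∀ {a} b → a ≡ true → a ∨ b ≡ true
∨-introˡ b refl = refl

∨-introʳ : ∀ a {b} → b ≡ true → a ∨ b ≡ true
∨-introʳ a refl = ∨-zeroʳ a

∧-elim : ∀ {a b} → a ∧ b ≡ true → a ≡ true × b ≡ true
∧-elim {true} {true} _ = refl , refl

anyFin-intro : ∀ {m} (f : Fin m → Bool) i → f i ≡ true → anyFin f ≡ true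
anyFin-intro f zero    fi = ∨-introˡ _ fi
anyFin-intro f (suc i) fi = ∨-introʳ (f zero) (anyFin-intro (λ j → f (suc j)) i fi)

anyFin-elim : ∀ {m} (f : Fin m → Bool) → anyFin f ≡ true → ∃[ i ] f i ≡ true
anyFin-elim {suc m} f any with f zero in f0
... | true  = zero , f0
... | false with anyFin-elim (λ j → f (suc j)) any
...   | i , fi = suc i , fi

same : ∀ {m} → Fin m → Fin m → Bool
same zero    zero    = true
same zero    (suc _) = false
same (suc _) zero    = false
same (suc u) (suc v) = same u v

same-refl : ∀ {m} (v : Fin m) → same v v ≡ true
same-refl zero    = refl
same-refl (suc v) = same-refl v

same⇒≡ : ∀ {m} (u v : Fin m) → same u v ≡ true → u ≡ v
same⇒≡ zero    zero    _ = refl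
same⇒≡ (suc u) (suc v) h = cong suc (same⇒≡ u v h)

∑-same : ∀ {m} (v : Fin m) (f : Fin m → ℚ) → sum (λ u → keepIf (same v u) (f u)) ≡ f v
∑-same {suc m} zero    f = trans (cong (f zero +_) (sum-replicate-zero m)) (+-identityʳ _)
∑-same         (suc v) f = trans (+-identityˡ _) (∑-same v (λ u → f (suc u)))

-- Splitting the weight of a vertex u of R according to its relation with a
-- vertex v: u is outside every neighbourhood of v, or in N⁺[v], or an
-- in-neighbour of v (the last two exclusive as the digraph is simple and loopless).
weight-partition : ∀ (r e a b : Bool) q → (e ≡ true → b ≡ false) → (a ≡ true → b ≡ false) →
  keepIf r q ≡ (keepIf (r ∧ not ((e ∨ a) ∨ b)) q + keepIf (e ∨ a) (keepIf r q)) + keepIf b (keepIf r q)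
weight-partition false e     a     b     q _ _ = sym (cong₂ _+_ (cong (0ℚ +_) (keepIf-zero (e ∨ a))) (keepIf-zero b))
weight-partition true  true  a     true  q e⇒¬b _ with e⇒¬b refl
... | ()
weight-partition true  false true  true  q _ a⇒¬b with a⇒¬b refl
... | ()
weight-partition true  true  a     false q _ _ = solve 1 (λ q → q := (con 0ℚ :+ q) :+ con 0ℚ) refl q
weight-partition true  false true  false q _ _ = solve 1 (λ q → q := (con 0ℚ :+ q) :+ con 0ℚ) refl q
weight-partition true  false false true  q _ _ = solve 1 (λ q → q := (con 0ℚ :+ con 0ℚ) :+ q) refl q
weight-partition true  false false false q _ _ = solve 1 (λ q → q := (q :+ con 0ℚ) :+ con 0ℚ) refl q

-- The covered weight of a vertex u can only grow when v is added to the
-- stable set and u's status is upgraded from R∖N[v] to R.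
coverage-grows : ∀ (r e a b c′ c : Bool) q → 0ℚ ≤ q → (c′ ≡ true → c ≡ true) → (e ∨ a ≡ true → c ≡ true) →
  keepIf (r ∧ not ((e ∨ a) ∨ b)) (keepIf c′ q) + keepIf (e ∨ a) (keepIf r q) ≤ keepIf r (keepIf c q)
coverage-grows false e     a     b     c′    c q _ _ _ = ≤-reflexive (cong (0ℚ +_) (keepIf-zero (e ∨ a)))
coverage-grows true  true  a     b     c′    c q _ _ e⇒c with e⇒c refl
... | refl = ≤-reflexive (+-identityˡ q)
coverage-grows true  false true  b     c′    c q _ _ a⇒c with a⇒c refl
... | refl = ≤-reflexive (+-identityˡ q)
coverage-grows true  false false true  c′    c q 0≤q _ _ = keepIf-nonneg c 0≤q
coverage-grows true  false false false true  c q _ c′⇒c _ with c′⇒c refl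
... | refl = ≤-reflexive (+-identityʳ q)
coverage-grows true  false false false false c q 0≤q _ _ = keepIf-nonneg c 0≤q

module Neighbourhoods {n : ℕ} (G : Digraph n) where

  N⁺ : Subset n → Fin n → Bool
  N⁺ = inClosedOutNbhd G

  N⁺-self : ∀ {S u} → lookup S u ≡ true → N⁺ S u ≡ true
  N⁺-self u∈S = ∨-introˡ _ u∈S

  N⁺-arc : ∀ {S x u} → lookup S x ≡ true → arc G x u ≡ true → N⁺ S u ≡ true
  N⁺-arc {S} {x} {u} x∈S xu = ∨-introʳ (lookup S u)
    (anyFin-intro (λ y → lookup S y ∧ arc G y u) x (subst (λ b → b ∧ arc G x u ≡ true) (sym x∈S) xu))

  N⁺-mono : ∀ {S′ S} → (∀ x → lookup S′ x ≡ true → lookup S x ≡ true) → ∀ u → N⁺ S′ u ≡ true → N⁺ S u ≡ true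
  N⁺-mono {S′} {S} S′⊆S u u∈N with lookup S′ u in u∈S′
  ... | true  = N⁺-self {S} (S′⊆S u u∈S′)
  ... | false with anyFin-elim (λ y → lookup S′ y ∧ arc G y u) u∈N
  ...   | x , x∈S′∧xu = N⁺-arc {S} (S′⊆S x (proj₁ (∧-elim x∈S′∧xu))) (proj₂ (∧-elim {lookup S′ x} x∈S′∧xu))

  out : Fin n → Fin n → Bool
  out v u = same v u ∨ arc G v u

  N⁺-out : ∀ {S v u} → lookup S v ≡ true → out v u ≡ true → N⁺ S u ≡ true
  N⁺-out {S} {v} {u} v∈S vu with same v u in v≟u
  ... | true  = N⁺-self {S} (subst (λ x → lookup S x ≡ true) (same⇒≡ v u v≟u) v∈S)
  ... | false = N⁺-arc {S} v∈S vu

  adjacent : Fin n → Fin n → Bool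
  adjacent v u = out v u ∨ arc G u v

  Stableᵇ : Subset n → Set
  Stableᵇ S = ∀ u v → lookup S u ≡ true → lookup S v ≡ true → arc G u v ≡ false

  Dominates : Subset n → Subset n → Set
  Dominates S R = ∀ u → lookup R u ≡ true → lookup S u ≡ false →
                  ∃[ s ] lookup S s ≡ true × (arc G s u ≡ true ⊎ arc G u s ≡ true)

  DominatingStable : Subset n → Set
  DominatingStable S = Stableᵇ S × Dominates S ⊤

  dominatingStable? : ∀ S → Dec (DominatingStable S)
  dominatingStable? S =
    all? (λ u → all? (λ v → (lookup S u ≟ᵇ true) →-dec ((lookup S v ≟ᵇ true) →-dec (arc G u v ≟ᵇ false))))
    ×-dec
    all? (λ u → (lookup ⊤ u ≟ᵇ true) →-dec ((lookup S u ≟ᵇ false) →-dec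
           any? (λ s → (lookup S s ≟ᵇ true) ×-dec ((arc G s u ≟ᵇ true) ⊎-dec (arc G u s ≟ᵇ true)))))

  -- A stable set dominating all vertices is a maximal stable set: any vertex
  -- added to it is joined by an arc to one of its vertices.
  dominatingStable⇒maximal : ∀ S → DominatingStable S → MaximalStable G S
  dominatingStable⇒maximal S (stable , dominates) = S-stable , S-maximal
    where
    S-stable : Stable G S
    S-stable u v u∈S v∈S = stable u v ([]=⇒lookup u∈S) ([]=⇒lookup v∈S)
    S-maximal : ∀ T → Stable G T → S ⊆ T → T ⊆ S
    S-maximal T T-stable S⊆T {x} x∈T with lookup S x in x∈?S
    ... | true  = lookup⇒[]= x S x∈?S
    ... | false with dominates x (lookup-replicate x true) x∈?S
    ...   | s , s∈S , inj₁ sx with trans (sym sx) (T-stable s x (S⊆T (lookup⇒[]= s S s∈S)) x∈T)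
    ...     | ()
    S-maximal T T-stable S⊆T {x} x∈T | false | s , s∈S , inj₂ xs
      with trans (sym xs) (T-stable x s x∈T (S⊆T (lookup⇒[]= s S s∈S)))
    ... | ()

  module Greedy (w : Fin n → ℚ) (w≥0 : ∀ u → 0ℚ ≤ w u) where

    W : Subset n → Fin n → ℚ
    W R u = keepIf (lookup R u) (w u)

    W-nonneg : ∀ R u → 0ℚ ≤ W R u
    W-nonneg R u = keepIf-nonneg (lookup R u) (w≥0 u)

    covered : Subset n → Subset n → Fin n → ℚ
    covered R S u = keepIf (lookup R u) (keepIf (N⁺ S u) (w u))

    covered-nonneg : ∀ R S u → 0ℚ ≤ covered R S u
    covered-nonneg R S u = keepIf-nonneg (lookup R u) (keepIf-nonneg (N⁺ S u) (w≥0 u))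

    outW inW : Subset n → Fin n → ℚ
    outW R v = sum (λ u → keepIf (out v u) (W R u))
    inW  R v = sum (λ u → keepIf (arc G u v) (W R u))

    outW-split : ∀ R v → outW R v ≡ W R v + sum (λ u → keepIf (arc G v u) (W R u))
    outW-split R v = begin
      sum (λ u → keepIf (same v u ∨ arc G v u) (W R u))
        ≡⟨ sum-cong-≗ (λ u → keepIf-∨ (same v u) (arc G v u) (W R u) (no-loop u)) ⟩
      sum (λ u → keepIf (same v u) (W R u) + keepIf (arc G v u) (W R u))
        ≡⟨ ∑-distrib-+ (λ u → keepIf (same v u) (W R u)) (λ u → keepIf (arc G v u) (W R u)) ⟩
      sum (λ u → keepIf (same v u) (W R u)) + sum (λ u → keepIf (arc G v u) (W R u))
        ≡⟨ cong (_+ sum (λ u → keepIf (arc G v u) (W R u))) (∑-same v (W R)) ⟩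
      W R v + sum (λ u → keepIf (arc G v u) (W R u)) ∎
      where
      open ≡-Reasoning
      no-loop : ∀ u → same v u ≡ true → arc G v u ≡ false
      no-loop u v≟u = subst (λ x → arc G v x ≡ false) (same⇒≡ v u v≟u) (loopless G v)

    -- Both Σᵥ W(v)·inW(v) and Σᵥ W(v)·(outW(v) − W(v)) sum W(u)·W(v) over
    -- the arcs uv; hence on average over R, in-weights do not exceed out-weights.
    averaging : ∀ R → sum (λ v → W R v * inW R v) ≤ sum (λ v → W R v * outW R v)
    averaging R = subst₂ _≤_ (trans (+-identityˡ arcs) arcs≡in) (sym out≡squares+arcs)
                    (+-monoˡ-≤ arcs (∑-nonneg (λ v → W²-nonneg v)))
      where
      arcs = sum (λ v → W R v * sum (λ u → keepIf (arc G v u) (W R u)))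
      W²-nonneg : ∀ v → 0ℚ ≤ W R v * W R v
      W²-nonneg v = nonNegative⁻¹ _ {{nonNeg*nonNeg⇒nonNeg (W R v) {{W≥0}} (W R v) {{W≥0}}}}
        where W≥0 = nonNegative (W-nonneg R v)
      out≡squares+arcs : sum (λ v → W R v * outW R v) ≡ sum (λ v → W R v * W R v) + arcs
      out≡squares+arcs = trans (sum-cong-≗ (λ v → trans (cong (W R v *_) (outW-split R v)) (*-distribˡ-+ (W R v) _ _)))
                               (∑-distrib-+ (λ v → W R v * W R v) _)
      arcs≡in : arcs ≡ sum (λ v → W R v * inW R v)
      arcs≡in = begin
        sum (λ v → W R v * sum (λ u → keepIf (arc G v u) (W R u)))
          ≡⟨ sum-cong-≗ (λ v → *-distribˡ-sum (W R v) (λ u → keepIf (arc G v u) (W R u))) ⟩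
        sum (λ v → sum (λ u → W R v * keepIf (arc G v u) (W R u)))
          ≡⟨ sum-cong-≗ (λ v → sum-cong-≗ (λ u → keepIf-swap (arc G v u) (W R u) (W R v))) ⟩
        sum (λ v → sum (λ u → W R u * keepIf (arc G v u) (W R v)))
          ≡⟨ ∑-comm (λ v u → W R u * keepIf (arc G v u) (W R v)) ⟩
        sum (λ u → sum (λ v → W R u * keepIf (arc G v u) (W R v)))
          ≡⟨ sym (sum-cong-≗ (λ u → *-distribˡ-sum (W R u) (λ v → keepIf (arc G v u) (W R v)))) ⟩
        sum (λ u → W R u * inW R u) ∎
        where open ≡-Reasoning

    -- If
    -- not, weighting the strict inequalities by W contradicts averaging when
    -- some weight is positive, and otherwise every in-weight is 0.
    pivot : ∀ R v₀ → lookup R v₀ ≡ true → ∃[ v ] lookup R v ≡ true × inW R v ≤ outW R v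
    pivot R v₀ v₀∈R with any? (λ v → (lookup R v ≟ᵇ true) ×-dec (inW R v ≤? outW R v))
    ... | yes (v , v∈R , in≤out) = v , v∈R , in≤out
    ... | no none with any? (λ u → 0ℚ <? W R u)
    ...   | yes (u , 0<Wu) = ⊥-elim (<-irrefl refl (<-≤-trans (∑-mono-< weighted-≤ u (weighted-< u 0<Wu)) (averaging R)))
      where
      out<in : ∀ v → lookup R v ≡ true → outW R v < inW R v
      out<in v v∈R = ≰⇒> (λ in≤out → none (v , v∈R , in≤out))
      weighted-≤ : ∀ v → W R v * outW R v ≤ W R v * inW R v
      weighted-≤ v with lookup R v in v∈R
      ... | true  = *-monoˡ-≤-nonNeg (w v) {{nonNegative (w≥0 v)}} (<⇒≤ (out<in v v∈R))
      ... | false = ≤-reflexive (trans (*-zeroˡ (outW R v)) (sym (*-zeroˡ (inW R v))))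
      weighted-< : ∀ u → 0ℚ < W R u → W R u * outW R u < W R u * inW R u
      weighted-< u 0<Wu with lookup R u in u∈R
      ... | true  = *-monoʳ-<-pos (w u) {{positive 0<Wu}} (out<in u u∈R)
      ... | false = ⊥-elim (<-irrefl refl 0<Wu)
    ...   | no no-weight = ⊥-elim (none (v₀ , v₀∈R , ≤-trans in≤0 (∑-nonneg (λ u → keepIf-nonneg (out v₀ u) (W-nonneg R u)))))
      where
      in≤0 : inW R v₀ ≤ 0ℚ
      in≤0 = subst (inW R v₀ ≤_) (sum-replicate-zero n)
               (∑-mono (λ u → keepIf-≤0 (arc G u v₀) (≮⇒≥ (λ 0<Wu → no-weight (u , 0<Wu)))))
        where
        keepIf-≤0 : ∀ b {q} → q ≤ 0ℚ → keepIf b q ≤ 0ℚ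
        keepIf-≤0 true  q≤0 = q≤0
        keepIf-≤0 false _   = ≤-refl

    record Partial (R : Subset n) : Set where
      field
        S         : Subset n
        S⊆R       : ∀ u → lookup S u ≡ true → lookup R u ≡ true
        stable    : Stableᵇ S
        dominates : Dominates S R
        bound     : sum (W R) ≤ sum (covered R S) + sum (covered R S)

    partial-empty : ∀ R → (∀ u → lookup R u ≡ false) → Partial R
    partial-empty R R-empty = record
      { S         = ∅
      ; S⊆R       = λ u u∈∅ → ⊥-elim (false≢true (trans (sym (lookup-replicate u false)) u∈∅))
      ; stable    = λ u _ u∈∅ _ → ⊥-elim (false≢true (trans (sym (lookup-replicate u false)) u∈∅))
      ; dominates = λ u u∈R _ → ⊥-elim (false≢true (trans (sym (R-empty u)) u∈R))
      ; bound     = subst (_≤ sum (covered R ∅) + sum (covered R ∅)) W≡0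
                      (+-mono-≤ (∑-nonneg (covered-nonneg R ∅)) (∑-nonneg (covered-nonneg R ∅)))
      }
      where
      ∅ = replicate n false
      false≢true : false ≢ true
      false≢true ()
      W≡0 : 0ℚ + 0ℚ ≡ sum (W R)
      W≡0 = sym (trans (sum-cong-≗ (λ u → cong (λ b → keepIf b (w u)) (R-empty u))) (sum-replicate-zero n))

    _∖N[_] : Subset n → Fin n → Subset n
    R ∖N[ v ] = tabulate (λ u → lookup R u ∧ not (adjacent v u))

    insert : Fin n → Subset n → Subset n
    insert v S = tabulate (λ u → same v u ∨ lookup S u)

    ∖N-⊂ : ∀ R v → lookup R v ≡ true → R ∖N[ v ] ⊂ R
    ∖N-⊂ R v v∈R = (λ {u} u∈R′ → lookup⇒[]= u R (proj₁ (∧-elim (trans (sym (lookup∘tabulate _ u)) ([]=⇒lookup u∈R′)))))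
                 , v , lookup⇒[]= v R v∈R , v∉R′
      where
      v∉R′ : v ∉ R ∖N[ v ]
      v∉R′ v∈R′ with trans (sym ([]=⇒lookup v∈R′)) (lookup∘tabulate _ v)
      ... | eq rewrite same-refl v | ∧-zeroʳ (lookup R v) with eq
      ... | ()

    module Extend (R : Subset n) (v : Fin n) (v∈R : lookup R v ≡ true) (P′ : Partial (R ∖N[ v ])) where
      open Partial P′ renaming (S to S′; S⊆R to S′⊆R′; stable to S′-stable; dominates to S′-dominates; bound to bound′)

      R′ = R ∖N[ v ]
      S  = insert v S′

      R′-lookup : ∀ u → lookup R′ u ≡ lookup R u ∧ not (adjacent v u)
      R′-lookup = lookup∘tabulate (λ u → lookup R u ∧ not (adjacent v u))

      S-lookup : ∀ u → lookup S u ≡ same v u ∨ lookup S′ u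
      S-lookup = lookup∘tabulate (λ u → same v u ∨ lookup S′ u)

      v∈S : lookup S v ≡ true
      v∈S = trans (S-lookup v) (∨-introˡ _ (same-refl v))

      S′⊆S : ∀ u → lookup S′ u ≡ true → lookup S u ≡ true
      S′⊆S u u∈S′ = trans (S-lookup u) (∨-introʳ (same v u) u∈S′)

      R′⊆R : ∀ u → lookup R′ u ≡ true → lookup R u ≡ true
      R′⊆R u u∈R′ = proj₁ (∧-elim (trans (sym (R′-lookup u)) u∈R′))

      R′-apart : ∀ u → lookup R′ u ≡ true → arc G v u ≡ false × arc G u v ≡ false
      R′-apart u u∈R′ with same v u | arc G v u | arc G u v | proj₂ (∧-elim {lookup R u} (trans (sym (R′-lookup u)) u∈R′))
      ... | false | false | false | _ = refl , refl

      apart⇒∈R′ : ∀ u → lookup R u ≡ true → same v u ≡ false → arc G v u ≡ false → arc G u v ≡ false →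
                  lookup R′ u ≡ true
      apart⇒∈R′ u u∈R v≢u vu uv rewrite R′-lookup u | u∈R | v≢u | vu | uv = refl

      S-cases : ∀ u → lookup S u ≡ true → v ≡ u ⊎ lookup S′ u ≡ true
      S-cases u u∈S with same v u in v≟u | lookup S′ u | trans (sym (S-lookup u)) u∈S
      ... | true  | _    | _ = inj₁ (same⇒≡ v u v≟u)
      ... | false | true | _ = inj₂ refl

      S⊆R : ∀ u → lookup S u ≡ true → lookup R u ≡ true
      S⊆R u u∈S with S-cases u u∈S
      ... | inj₁ refl = v∈R
      ... | inj₂ u∈S′ = R′⊆R u (S′⊆R′ u u∈S′)

      S-stable : Stableᵇ S
      S-stable a b a∈S b∈S with S-cases a a∈S | S-cases b b∈S
      ... | inj₁ refl | inj₁ refl = loopless G v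
      ... | inj₁ refl | inj₂ b∈S′ = proj₁ (R′-apart b (S′⊆R′ b b∈S′))
      ... | inj₂ a∈S′ | inj₁ refl = proj₂ (R′-apart a (S′⊆R′ a a∈S′))
      ... | inj₂ a∈S′ | inj₂ b∈S′ = S′-stable a b a∈S′ b∈S′

      -- A vertex of R outside S is joined to v, or else lies in R′ and is
      -- dominated by S′.
      S-dominates : Dominates S R
      S-dominates u u∈R u∉S with same v u in v≟u | lookup S′ u in u∈?S′ | trans (sym (S-lookup u)) u∉S
      ... | false | false | _ with arc G v u in vu | arc G u v in uv
      ...   | true  | _    = v , v∈S , inj₁ vu
      ...   | false | true = v , v∈S , inj₂ uv
      ...   | false | false with S′-dominates u (apart⇒∈R′ u u∈R v≟u vu uv) u∈?S′
      ...     | s , s∈S′ , s~u = s , S′⊆S s s∈S′ , s~u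

      weight-split : ∀ u → W R u ≡ (W R′ u + keepIf (out v u) (W R u)) + keepIf (arc G u v) (W R u)
      weight-split u =
        trans (weight-partition (lookup R u) (same v u) (arc G v u) (arc G u v) (w u) no-loop (simple G v u))
              (cong (λ r → (keepIf r (w u) + keepIf (out v u) (W R u)) + keepIf (arc G u v) (W R u))
                    (sym (R′-lookup u)))
        where
        no-loop : same v u ≡ true → arc G u v ≡ false
        no-loop v≟u = subst (λ x → arc G x v ≡ false) (same⇒≡ v u v≟u) (loopless G v)

      coverage-split : ∀ u → covered R′ S′ u + keepIf (out v u) (W R u) ≤ covered R S u
      coverage-split u =
        subst (λ r → keepIf r (keepIf (N⁺ S′ u) (w u)) + keepIf (out v u) (W R u) ≤ covered R S u)
              (sym (R′-lookup u))
              (coverage-grows (lookup R u) (same v u) (arc G v u) (arc G u v) (N⁺ S′ u) (N⁺ S u) (w u) (w≥0 u)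
                              (N⁺-mono {S′} {S} S′⊆S u) (N⁺-out {S} v∈S))

      S-bound : inW R v ≤ outW R v → sum (W R) ≤ sum (covered R S) + sum (covered R S)
      S-bound in≤out = begin
        sum (W R)                               ≡⟨ weight-sum ⟩
        (sum (W R′) + outW R v) + inW R v       ≤⟨ +-mono-≤ (+-monoˡ-≤ (outW R v) bound′) in≤out ⟩
        ((c′ + c′) + outW R v) + outW R v       ≡⟨ solve 2 (λ c o → ((c :+ c) :+ o) :+ o := (c :+ o) :+ (c :+ o)) refl c′ (outW R v) ⟩
        (c′ + outW R v) + (c′ + outW R v)       ≤⟨ +-mono-≤ coverage-sum coverage-sum ⟩
        sum (covered R S) + sum (covered R S)   ∎
        where
        open ≤-Reasoning
        c′ = sum (covered R′ S′)
        O = λ u → keepIf (out v u) (W R u)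
        I = λ u → keepIf (arc G u v) (W R u)
        weight-sum : sum (W R) ≡ (sum (W R′) + outW R v) + inW R v
        weight-sum = trans (sum-cong-≗ weight-split)
                           (trans (∑-distrib-+ (λ u → W R′ u + O u) I) (cong (_+ inW R v) (∑-distrib-+ (W R′) O)))
        coverage-sum : c′ + outW R v ≤ sum (covered R S)
        coverage-sum = subst (_≤ sum (covered R S)) (∑-distrib-+ (covered R′ S′) O) (∑-mono coverage-split)

      partial : inW R v ≤ outW R v → Partial R
      partial in≤out = record
        { S = S ; S⊆R = S⊆R ; stable = S-stable ; dominates = S-dominates ; bound = S-bound in≤out }

    greedy : ∀ R → Acc _⊂_ R → Partial R
    greedy R (acc smaller) with any? (λ u → lookup R u ≟ᵇ true)
    ... | no empty = partial-empty R (λ u → ¬-not (λ u∈R → empty (u , u∈R)))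
    ... | yes (v₀ , v₀∈R) with pivot R v₀ v₀∈R
    ...   | v , v∈R , in≤out = Extend.partial R v v∈R (greedy (R ∖N[ v ]) (smaller (∖N-⊂ R v v∈R))) in≤out

  weighted-domination : ∀ (w : Fin n → ℚ) → (∀ u → 0ℚ ≤ w u) →
    ∃[ S ] DominatingStable S × sum w ≤ sum (λ u → keepIf (N⁺ S u) (w u)) + sum (λ u → keepIf (N⁺ S u) (w u))
  weighted-domination w w≥0 = S , (stable , dominates) , subst₂ _≤_ W⊤≡w (cong₂ _+_ covered≡ covered≡) bound
    where
    open Greedy w w≥0
    open Partial (greedy ⊤ (⊂-wellFounded ⊤))
    W⊤≡w : sum (W ⊤) ≡ sum w
    W⊤≡w = sum-cong-≗ (λ u → cong (λ b → keepIf b (w u)) (lookup-replicate u true))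
    covered≡ : sum (covered ⊤ S) ≡ sum (λ u → keepIf (N⁺ S u) (w u))
    covered≡ = sum-cong-≗ (λ u → cong (λ b → keepIf b (keepIf (N⁺ S u) (w u))) (lookup-replicate u true))

module CoveringLP {n : ℕ} (G : Digraph n) where
  open Neighbourhoods G

  M : ℕ
  M = #subsets n

  column : Subset n → Bool
  column S = does (dominatingStable? S)

  -- A(v, i) = [v ∈ N⁺[Sᵢ]] for a column Sᵢ, and 0 for other subsets.
  A : Fin n → Fin M → ℚ
  A v i = keepIf (N⁺ (subsetAt i) v) (keepIf (column (subsetAt i)) 1ℚ)

  nonneg : Fin M → Ineq M
  nonneg i = ineq (λ j → keepIf (same i j) 1ℚ) 0ℚ

  cover : Fin n → Ineq M
  cover v = ineq (A v) 1ℚ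

  total : Ineq M
  total = ineq (λ _ → - 1ℚ) (- (1ℚ + 1ℚ))

  system : List (Ineq M)
  system = map nonneg (allFin M) ++ map cover (allFin n) ++ total ∷ᴸ []ᴸ

  -- e is implied by the system through multipliers y ≥ 0 on the covering
  -- constraints and t ≥ 0 on the total constraint (plus a non-negative
  -- combination of the constraints xᵢ ≥ 0).
  record Certificate (e : Ineq M) : Set where
    field
      y     : Fin n → ℚ
      t     : ℚ
      y≥0   : ∀ v → 0ℚ ≤ y v
      t≥0   : 0ℚ ≤ t
      rhs≤  : rhs e ≤ sum y - (t + t)
      coef≥ : ∀ i → sum (λ v → y v * A v i) - t ≤ coef e i

  -- Certificates form a consistent notion of derivability: the sound part
  -- is where the digraph enters, through weighted-domination.
  certificates-consistent : Consistent Certificate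
  certificates-consistent = record { coef-cong = coef-cong ; conic = conic ; sound = sound }
    where
    coef-cong : ∀ {c c′ b} → (∀ i → c i ≡ c′ i) → Certificate (ineq c b) → Certificate (ineq c′ b)
    coef-cong c≗c′ cert = record
      { y = y ; t = t ; y≥0 = y≥0 ; t≥0 = t≥0 ; rhs≤ = rhs≤ ; coef≥ = λ i → subst (_ ≤_) (c≗c′ i) (coef≥ i) }
      where open Certificate cert

    conic : ∀ {α β e f} → 0ℚ ≤ α → 0ℚ ≤ β → Certificate e → Certificate f → Certificate (combine α e β f)
    conic {α} {β} {e} {f} 0≤α 0≤β c₁ c₂ = record
      { y     = y
      ; t     = t
      ; y≥0   = λ v → combine-nonneg 0≤α 0≤β (C₁.y≥0 v) (C₂.y≥0 v)
      ; t≥0   = combine-nonneg 0≤α 0≤β C₁.t≥0 C₂.t≥0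
      ; rhs≤  = subst (rhs (combine α e β f) ≤_) rhs-eq (combine-mono 0≤α 0≤β C₁.rhs≤ C₂.rhs≤)
      ; coef≥ = λ i → subst (_≤ coef (combine α e β f) i) (coef-eq i) (combine-mono 0≤α 0≤β (C₁.coef≥ i) (C₂.coef≥ i))
      }
      where
      module C₁ = Certificate c₁
      module C₂ = Certificate c₂
      y = λ v → α * C₁.y v + β * C₂.y v
      t = α * C₁.t + β * C₂.t
      regroup : ∀ a₁ a₂ t₁ t₂ → α * (a₁ - t₁) + β * (a₂ - t₂) ≡ (α * a₁ + β * a₂) - (α * t₁ + β * t₂)
      regroup = solve 6 (λ α β a₁ a₂ t₁ t₂ → α :* (a₁ :- t₁) :+ β :* (a₂ :- t₂) := (α :* a₁ :+ β :* a₂) :- (α :* t₁ :+ β :* t₂)) refl α β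
      rhs-eq : α * (sum C₁.y - (C₁.t + C₁.t))
             + β * (sum C₂.y - (C₂.t + C₂.t)) ≡ sum y - (t + t)
      rhs-eq = trans (regroup _ _ _ _)
                     (cong₂ _-_ (sym (∑-linear α β C₁.y C₂.y))
                                (solve 4 (λ α β t₁ t₂ → α :* (t₁ :+ t₁) :+ β :* (t₂ :+ t₂) := (α :* t₁ :+ β :* t₂) :+ (α :* t₁ :+ β :* t₂))
                                       refl α β C₁.t C₂.t))
      coef-eq : ∀ i → α * (sum (λ v → C₁.y v * A v i) - C₁.t)
                    + β * (sum (λ v → C₂.y v * A v i) - C₂.t) ≡ sum (λ v → y v * A v i) - t
      coef-eq i = trans (regroup _ _ _ _) (cong (_- t) (sym (trans
        (sum-cong-≗ (λ v → solve 5 (λ α a β b c → (α :* a :+ β :* b) :* c := α :* (a :* c) :+ β :* (b :* c))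
                                   refl α (C₁.y v) β (C₂.y v) (A v i)))
        (∑-linear α β (λ v → C₁.y v * A v i) (λ v → C₂.y v * A v i)))))

    -- With all coefficients 0, the certificate says y(N⁺[S]) ≤ t for every
    -- column S, while weighted-domination yields a column with y(V) ≤ 2·y(N⁺[S]).
    sound : ∀ {e} → Certificate e → (∀ i → coef e i ≡ 0ℚ) → rhs e ≤ 0ℚ
    sound {e} cert c≡0 with weighted-domination (Certificate.y cert) (Certificate.y≥0 cert)
    ... | S , S-ok , y≤2·y[S] = ≤-trans rhs≤ (≤-trans (+-monoˡ-≤ (- (t + t)) y≤2·y[S]) twice≤0)
      where
      open Certificate cert
      y[S] = sum (λ v → keepIf (N⁺ S v) (y v))
      column-entry : ∀ v → y v * A v (indexOf S) ≡ keepIf (N⁺ S v) (y v)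
      column-entry v rewrite subsetAt-indexOf S | dec-true (dominatingStable? S) S-ok =
        trans (keepIf-swap (N⁺ S v) 1ℚ (y v)) (*-identityˡ _)
      y[S]≤t : y[S] - t ≤ 0ℚ
      y[S]≤t = subst₂ (λ a b → a - t ≤ b) (sum-cong-≗ column-entry) (c≡0 (indexOf S)) (coef≥ (indexOf S))
      twice≤0 : (y[S] + y[S]) - (t + t) ≤ 0ℚ
      twice≤0 = subst₂ _≤_ (solve 2 (λ c t → (c :- t) :+ (c :- t) := (c :+ c) :- (t :+ t)) refl y[S] t)
                           (+-identityʳ 0ℚ) (+-mono-≤ y[S]≤t y[S]≤t)

  0≤1 : 0ℚ ≤ 1ℚ
  0≤1 = nonNegative⁻¹ 1ℚ

  no-multipliers : ∀ i → sum (λ v → 0ℚ * A v i) ≡ 0ℚ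
  no-multipliers i = trans (sum-cong-≗ (λ v → *-zeroˡ (A v i))) (sum-replicate-zero n)

  nonneg-certified : ∀ i → Certificate (nonneg i)
  nonneg-certified i = record
    { y = λ _ → 0ℚ ; t = 0ℚ ; y≥0 = λ _ → ≤-refl ; t≥0 = ≤-refl
    ; rhs≤  = ≤-reflexive (sym (cong (_- (0ℚ + 0ℚ)) (sum-replicate-zero n)))
    ; coef≥ = λ j → subst (_≤ keepIf (same i j) 1ℚ) (sym (cong (_- 0ℚ) (no-multipliers j)))
                          (keepIf-nonneg (same i j) 0≤1)
    }

  cover-certified : ∀ v → Certificate (cover v)
  cover-certified v = record
    { y = λ u → keepIf (same v u) 1ℚ ; t = 0ℚ ; y≥0 = λ u → keepIf-nonneg (same v u) 0≤1 ; t≥0 = ≤-refl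
    ; rhs≤  = ≤-reflexive (sym (cong (_- (0ℚ + 0ℚ)) (∑-same v (λ _ → 1ℚ))))
    ; coef≥ = λ i → ≤-reflexive (trans (cong (_- 0ℚ) (trans (sum-cong-≗ (λ u → keepIf-one (same v u) (A u i)))
                                                            (∑-same v (λ u → A u i))))
                                       (+-identityʳ (A v i)))
    }

  total-certified : Certificate total
  total-certified = record
    { y = λ _ → 0ℚ ; t = 1ℚ ; y≥0 = λ _ → ≤-refl ; t≥0 = 0≤1
    ; rhs≤  = ≤-reflexive (sym (cong (_- (1ℚ + 1ℚ)) (sum-replicate-zero n)))
    ; coef≥ = λ i → ≤-reflexive (cong (_- 1ℚ) (no-multipliers i))
    }

  system-certified : All Certificate system
  system-certified = AllP.++⁺ (AllP.map⁺ (AllP.tabulate⁺ nonneg-certified))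
                    (AllP.++⁺ (AllP.map⁺ (AllP.tabulate⁺ cover-certified)) (total-certified All.∷ All.[]))

  feasible : ∃[ x ] All (x ⊨_) system
  feasible = fourier-motzkin certificates-consistent system system-certified

  x : Fin M → ℚ
  x = proj₁ feasible

  x-nonneg : ∀ i → 0ℚ ≤ x i
  x-nonneg i = subst (0ℚ ≤_) (trans (sum-cong-≗ (λ j → keepIf-one (same i j) (x j))) (∑-same i x))
                     (All.lookup (proj₂ feasible) (∈-++⁺ˡ (∈-map⁺ nonneg (∈-allFin i))))

  x-covers : ∀ v → 1ℚ ≤ sum (λ i → A v i * x i)
  x-covers v = All.lookup (proj₂ feasible) (∈-++⁺ʳ (map nonneg (allFin M)) (∈-++⁺ˡ (∈-map⁺ cover (∈-allFin v))))

  x-total : sum x ≤ 1ℚ + 1ℚ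
  x-total = subst₂ _≤_ (solve 1 (λ s → :- (:- s) := s) refl (sum x)) refl
                       (neg-antimono-≤ (subst (- (1ℚ + 1ℚ) ≤_) -∑x total-holds))
    where
    total-holds = All.lookup (proj₂ feasible)
      (∈-++⁺ʳ (map nonneg (allFin M)) (∈-++⁺ʳ (map cover (allFin n)) (here refl)))
    -∑x : sum (λ i → - 1ℚ * x i) ≡ - sum x
    -∑x = trans (sym (*-distribˡ-sum (- 1ℚ) x)) (solve 1 (λ s → :- con 1ℚ :* s := :- s) refl (sum x))

  z : Subset n → ℚ
  z S = keepIf (column S) (x (indexOf S))

  z-off-maximal : ∀ S → ¬ MaximalStable G S → z S ≡ 0ℚ
  z-off-maximal S not-maximal =
    cong (λ b → keepIf b (x (indexOf S)))
         (dec-false (dominatingStable? S) (λ S-ok → not-maximal (dominatingStable⇒maximal S S-ok)))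

  z-nonneg : ∀ S → 0ℚ ≤ z S
  z-nonneg S = keepIf-nonneg (column S) (x-nonneg (indexOf S))

  z-covers : ∀ v → 1ℚ ≤ sumSubsets n (λ S → if N⁺ S v then z S else 0ℚ)
  z-covers v = subst (1ℚ ≤_) (sym (trans (sumSubsets-∑ n (λ S → keepIf (N⁺ S v) (z S))) (sum-cong-≗ entry)))
                     (x-covers v)
    where
    entry : ∀ i → keepIf (N⁺ (subsetAt i) v) (z (subsetAt i)) ≡ A v i * x i
    entry i = trans (cong (λ j → keepIf (N⁺ (subsetAt i) v) (keepIf (column (subsetAt i)) (x j))) (indexOf-subsetAt {n} i))
                    (keepIf-nested (N⁺ (subsetAt i) v) (column (subsetAt i)) (x i))

  z-total : sumSubsets n z ≤ 1ℚ + 1ℚ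
  z-total = subst (_≤ 1ℚ + 1ℚ) (sym (sumSubsets-∑ n z)) (≤-trans (∑-mono z≤x) x-total)
    where
    z≤x : ∀ i → z (subsetAt i) ≤ x i
    z≤x i = subst (λ j → keepIf (column (subsetAt i)) (x j) ≤ x i) (sym (indexOf-subsetAt {n} i))
                  (keepIf-≤ (column (subsetAt i)) (x-nonneg i))

lemma6 : ∀ (n : ℕ) (G : Digraph n) →
    ∃[ z ] ((∀ (S : Subset n) → ¬ MaximalStable G S → z S ≡ 0ℚ)
    × (∀ (S : Subset n) → 0ℚ ≤ z S)
    × (∀ (v : Fin n) → 1ℚ ≤ sumSubsets n (λ S → if inClosedOutNbhd G S v then z S else 0ℚ))
    × sumSubsets n z ≤ 1ℚ + 1ℚ)
lemma6 n G = z , z-off-maximal , z-nonneg , z-covers , z-total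
  where open CoveringLP G
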